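{- Let $\mathbf A=(A,\wedge,\vee,\cdot,\backslash,\slash)$ be a unital residuated binar whose lattice reduct is complemented. If $\mathbf A$ satisfies any one of the identities $$x (y\wedge z) = x y\wedge x z,\quad (x\wedge y) z = x z\wedge y z,\quad (x\wedge y)\backslash z = x\backslash z\vee y\backslash z,\quad x\slash (y\wedge z) = x\slash y\vee x\slash z,$$ then $\mathbf A$ is a Boolean algebra, in the sense that $x\cdot y=x\wedge y$ for all $x,y\in A$ and the lattice reduct is a Boolean lattice (so $\mathbf A$ is term-equivalent to a Boolean algebra).
   Context: A residuated binar is an algebra $\mathbf A=(A,\wedge,\vee,\cdot,\backslash,\slash)$ where $(A,\wedge,\vee)$ is a lattice, $\cdot$ is a binary operation on $A$ (written $xy$), and for all $x,y,z\in A$: $x\cdot y\le z \iff x\le z\slash y \iff y\le x\backslash z$. It is unital if $\cdot$ has an identity element $e$. Complemented means the lattice is bounded and every element has a complement (distributivity not assumed). Convention: $\cdot$ binds more tightly than $\backslash,\slash$, which bind more tightly than $\wedge,\vee$. -}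

module Defs where

open import Level using (Level; _⊔_; suc)
open import Data.Product using (Σ; _×_)
open import Data.Sum using (_⊎_)
open import Algebra.Core using (Op₂)
open import Algebra.Definitions using (Congruent₂; Identity)
open import Algebra.Lattice.Structures using (IsLattice; IsDistributiveLattice)
open import Relation.Binary.Core using (Rel)

record ResiduatedBinar (c ℓ : Level) : Set (suc (c ⊔ ℓ)) where
  infixr 7 _·_
  infixr 6 _\\_ _//_
  infixr 5 _∧_
  infixr 4 _∨_
  infix  3 _≈_ _≤_
  field
    Carrier   : Set c
    _≈_       : Rel Carrier ℓ
    _∧_       : Op₂ Carrier
    _∨_       : Op₂ Carrier
    _·_       : Op₂ Carrier
    _\\_      : Op₂ Carrier
    _//_      : Op₂ Carrier
    isLattice : IsLattice _≈_ _∨_ _∧_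
    ·-cong    : Congruent₂ _≈_ _·_
    \\-cong   : Congruent₂ _≈_ _\\_
    //-cong   : Congruent₂ _≈_ _//_

  _≤_ : Rel Carrier ℓ
  x ≤ y = (x ∧ y) ≈ x

  field
    resid₁ : ∀ x y z → (x · y) ≤ z → x ≤ (z // y)
    resid₂ : ∀ x y z → x ≤ (z // y) → (x · y) ≤ z
    resid₃ : ∀ x y z → (x · y) ≤ z → y ≤ (x \\ z)
    resid₄ : ∀ x y z → y ≤ (x \\ z) → (x · y) ≤ z

  open IsLattice isLattice public

Unital : ∀ {c ℓ} → ResiduatedBinar c ℓ → Set (c ⊔ ℓ)
Unital A = Σ Carrier λ e → Identity _≈_ e _·_
  where open ResiduatedBinar A

Complemented : ∀ {c ℓ} → ResiduatedBinar c ℓ → Set (c ⊔ ℓ)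
Complemented A =
  Σ Carrier λ bot → Σ Carrier λ top →
    (∀ x → (bot ≤ x) × (x ≤ top)) ×
    (∀ x → Σ Carrier λ y → ((x ∧ y) ≈ bot) × ((x ∨ y) ≈ top))
  where open ResiduatedBinar A

IdentityI : ∀ {c ℓ} → ResiduatedBinar c ℓ → Set (c ⊔ ℓ)
IdentityI A = ∀ x y z → (x · (y ∧ z)) ≈ ((x · y) ∧ (x · z))
  where open ResiduatedBinar A

IdentityII : ∀ {c ℓ} → ResiduatedBinar c ℓ → Set (c ⊔ ℓ)
IdentityII A = ∀ x y z → ((x ∧ y) · z) ≈ ((x · z) ∧ (y · z))
  where open ResiduatedBinar A

IdentityIII : ∀ {c ℓ} → ResiduatedBinar c ℓ → Set (c ⊔ ℓ)
IdentityIII A = ∀ x y z → ((x ∧ y) \\ z) ≈ ((x \\ z) ∨ (y \\ z))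
  where open ResiduatedBinar A

IdentityIV : ∀ {c ℓ} → ResiduatedBinar c ℓ → Set (c ⊔ ℓ)
IdentityIV A = ∀ x y z → (x // (y ∧ z)) ≈ ((x // y) ∨ (x // z))
  where open ResiduatedBinar A

-- Boolean algebra in the paper's sense: x·y = x ∧ y for all x, y, and the
-- lattice reduct is Boolean (distributive + complemented; complementation
-- with bounds is a standing hypothesis, so we require distributivity and
-- restate complementedness).
IsBooleanResiduatedBinar : ∀ {c ℓ} → ResiduatedBinar c ℓ → Set (c ⊔ ℓ)
IsBooleanResiduatedBinar A =
  (∀ x y → (x · y) ≈ (x ∧ y)) ×
  IsDistributiveLattice _≈_ _∨_ _∧_ ×
  Complemented A
  where open ResiduatedBinar A

-- The unit e is forced to be the top element. For a complement ē of e, each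
-- identity, applied to e ∧ ē = ⊥ together with ⊤ · ⊥ = ⊥ = ⊥ · ⊤ (for the
-- residual identities: ⊥ \\ ⊥ = ⊤ = ⊥ // ⊥ and e \\ ⊥ = ⊥ = ⊥ // e), yields
-- ⊤ · ē = ⊥ or ē · ⊤ = ⊥; hence ē ≤ ⊥ and e = e ∨ ē = ⊤. Once e = ⊤ we get
-- x · y ≤ x · e ∧ e · y = x ∧ y, and x = x · (x ∨ x̄) = x · x ∨ x · x̄ = x · x,
-- so monotonicity gives x ∧ y ≤ (x ∧ y) · (x ∧ y) ≤ x · y. Distributivity of ·
-- over ∨, valid in every residuated binar, then becomes that of ∧ over ∨.
module Submission where

open import Defs
open import Level using (Level)
open import Data.Product using (Σ; _×_; _,_; proj₁; proj₂)
open import Data.Sum using (_⊎_; inj₁; inj₂)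
open import Algebra.Definitions
  using (Identity; LeftIdentity; RightIdentity; LeftZero; RightZero; _DistributesOver_; _DistributesOverˡ_)
open import Algebra.Consequences.Setoid using (comm∧distrˡ⇒distr; distrib∧absorbs⇒distribˡ)
open import Algebra.Lattice.Bundles using (Lattice)
open import Algebra.Lattice.Structures using (IsDistributiveLattice)
import Algebra.Lattice.Properties.Lattice as LatticeProperties
import Relation.Binary.Lattice as OrderTheoretic
open import Relation.Binary.Definitions using (Minimum; Maximum)
import Relation.Binary.Reasoning.PartialOrder as ≤-Reasoning

∧-distribˡ-∨⇒isDistributiveLattice : ∀ {c ℓ} (L : Lattice c ℓ) → let open Lattice L in
  _DistributesOverˡ_ _≈_ _∧_ _∨_ → IsDistributiveLattice _≈_ _∨_ _∧_
∧-distribˡ-∨⇒isDistributiveLattice L ∧-distribˡ-∨ = record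
  { isLattice   = isLattice
  ; ∨-distrib-∧ = comm∧distrˡ⇒distr setoid ∧-cong ∨-comm ∨-distribˡ-∧
  ; ∧-distrib-∨ = ∧-distrib-∨
  }
  where
  open Lattice L
  ∧-distrib-∨ : _DistributesOver_ _≈_ _∧_ _∨_
  ∧-distrib-∨ = comm∧distrˡ⇒distr setoid ∨-cong ∧-comm ∧-distribˡ-∨
  ∨-distribˡ-∧ : _DistributesOverˡ_ _≈_ _∨_ _∧_
  ∨-distribˡ-∧ = distrib∧absorbs⇒distribˡ setoid ∨-cong ∨-assoc ∧-comm
                   ∨-absorbs-∧ ∧-absorbs-∨ ∧-distrib-∨

module _ {c ℓ} (A : ResiduatedBinar c ℓ) where
  open ResiduatedBinar A hiding (_≤_)

  lattice : Lattice c ℓ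
  lattice = record { isLattice = isLattice }

  open LatticeProperties lattice using (poset; ∨-∧-orderTheoreticLattice)
  open OrderTheoretic.Lattice ∨-∧-orderTheoreticLattice
    using (_≤_; antisym; ≤-respʳ-≈; x∧y≤x; x∧y≤y; ∧-greatest; x≤x∨y; y≤x∨y; ∨-least)
    renaming (refl to ≤-refl; reflexive to ≤-reflexive; trans to ≤-trans)
  open ≤-Reasoning poset

  private variable x y z : Carrier

  -- The order of the record is x ∧ y ≈ x; the library's is x ≈ x ∧ y.
  ·≤⇒≤// : x · y ≤ z → x ≤ z // y
  ·≤⇒≤// p = sym (resid₁ _ _ _ (sym p))

  ≤//⇒·≤ : x ≤ z // y → x · y ≤ z
  ≤//⇒·≤ p = sym (resid₂ _ _ _ (sym p))

  ·≤⇒≤\\ : x · y ≤ z → y ≤ x \\ z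
  ·≤⇒≤\\ p = sym (resid₃ _ _ _ (sym p))

  ≤\\⇒·≤ : y ≤ x \\ z → x · y ≤ z
  ≤\\⇒·≤ p = sym (resid₄ _ _ _ (sym p))

  ·-monoˡ-≤ : x ≤ y → x · z ≤ y · z
  ·-monoˡ-≤ x≤y = ≤//⇒·≤ (≤-trans x≤y (·≤⇒≤// ≤-refl))

  ·-monoʳ-≤ : x ≤ y → z · x ≤ z · y
  ·-monoʳ-≤ x≤y = ≤\\⇒·≤ (≤-trans x≤y (·≤⇒≤\\ ≤-refl))

  ·-distribˡ-∨ : _DistributesOverˡ_ _≈_ _·_ _∨_
  ·-distribˡ-∨ x y z = antisym
    (≤\\⇒·≤ (∨-least (·≤⇒≤\\ (x≤x∨y _ _)) (·≤⇒≤\\ (y≤x∨y _ _))))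
    (∨-least (·-monoʳ-≤ (x≤x∨y y z)) (·-monoʳ-≤ (y≤x∨y y z)))

  module _ {⊥ : Carrier} (⊥-minimum : Minimum _≤_ ⊥) where

    ·-zeroˡ : LeftZero _≈_ ⊥ _·_
    ·-zeroˡ x = antisym (≤//⇒·≤ (⊥-minimum _)) (⊥-minimum _)

    ·-zeroʳ : RightZero _≈_ ⊥ _·_
    ·-zeroʳ x = antisym (≤\\⇒·≤ (⊥-minimum _)) (⊥-minimum _)

  module _ {e : Carrier} (e-identity : Identity _≈_ e _·_) where

    private
      ·-identityˡ : LeftIdentity _≈_ e _·_
      ·-identityˡ = proj₁ e-identity
      ·-identityʳ : RightIdentity _≈_ e _·_
      ·-identityʳ = proj₂ e-identity

    \\-identityˡ : ∀ x → e \\ x ≈ x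
    \\-identityˡ x = antisym
      (begin
        e \\ x        ≈⟨ ·-identityˡ (e \\ x) ⟨
        e · (e \\ x)  ≤⟨ ≤\\⇒·≤ ≤-refl ⟩
        x             ∎)
      (·≤⇒≤\\ (≤-reflexive (·-identityˡ x)))

    //-identityʳ : ∀ x → x // e ≈ x
    //-identityʳ x = antisym
      (begin
        x // e        ≈⟨ ·-identityʳ (x // e) ⟨
        (x // e) · e  ≤⟨ ≤//⇒·≤ ≤-refl ⟩
        x             ∎)
      (·≤⇒≤// (≤-reflexive (·-identityʳ x)))

    x·y≤x∧y : Maximum _≤_ e → ∀ x y → x · y ≤ x ∧ y
    x·y≤x∧y e-maximum x y = ∧-greatest
      (≤-trans (·-monoʳ-≤ (e-maximum y)) (≤-reflexive (·-identityʳ x)))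
      (≤-trans (·-monoˡ-≤ (e-maximum x)) (≤-reflexive (·-identityˡ y)))

  module UnitalComplemented (unital : Unital A) (complemented : Complemented A) where

    e : Carrier
    e = proj₁ unital

    e-identity : Identity _≈_ e _·_
    e-identity = proj₂ unital

    ·-identityˡ : LeftIdentity _≈_ e _·_
    ·-identityˡ = proj₁ e-identity

    ·-identityʳ : RightIdentity _≈_ e _·_
    ·-identityʳ = proj₂ e-identity

    ⊥ ⊤ : Carrier
    ⊥ = proj₁ complemented
    ⊤ = proj₁ (proj₂ complemented)

    ⊥-minimum : Minimum _≤_ ⊥
    ⊥-minimum x = sym (proj₁ (proj₁ (proj₂ (proj₂ complemented)) x))

    ⊤-maximum : Maximum _≤_ ⊤
    ⊤-maximum x = sym (proj₂ (proj₁ (proj₂ (proj₂ complemented)) x))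

    complement : ∀ x → Σ Carrier λ x̄ → x ∧ x̄ ≈ ⊥ × x ∨ x̄ ≈ ⊤
    complement = proj₂ (proj₂ (proj₂ complemented))

    ē : Carrier
    ē = proj₁ (complement e)

    e∧ē≈⊥ : e ∧ ē ≈ ⊥
    e∧ē≈⊥ = proj₁ (proj₂ (complement e))

    e∨ē≈⊤ : e ∨ ē ≈ ⊤
    e∨ē≈⊤ = proj₂ (proj₂ (complement e))

    ē≤⊥⇒e≈⊤ : ē ≤ ⊥ → e ≈ ⊤
    ē≤⊥⇒e≈⊤ ē≤⊥ = trans
      (antisym (x≤x∨y e ē) (∨-least ≤-refl (≤-trans ē≤⊥ (⊥-minimum e))))
      e∨ē≈⊤

    ⊤·ē≤⊥⇒e≈⊤ : ⊤ · ē ≤ ⊥ → e ≈ ⊤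
    ⊤·ē≤⊥⇒e≈⊤ ⊤·ē≤⊥ = ē≤⊥⇒e≈⊤ (begin
      ē      ≈⟨ ·-identityˡ ē ⟨
      e · ē  ≤⟨ ·-monoˡ-≤ (⊤-maximum e) ⟩
      ⊤ · ē  ≤⟨ ⊤·ē≤⊥ ⟩
      ⊥      ∎)

    ē·⊤≤⊥⇒e≈⊤ : ē · ⊤ ≤ ⊥ → e ≈ ⊤
    ē·⊤≤⊥⇒e≈⊤ ē·⊤≤⊥ = ē≤⊥⇒e≈⊤ (begin
      ē      ≈⟨ ·-identityʳ ē ⟨
      ē · e  ≤⟨ ·-monoʳ-≤ (⊤-maximum e) ⟩
      ē · ⊤  ≤⟨ ē·⊤≤⊥ ⟩
      ⊥      ∎)

    identityI⇒e≈⊤ : IdentityI A → e ≈ ⊤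
    identityI⇒e≈⊤ ·-distribˡ-∧ = ⊤·ē≤⊥⇒e≈⊤ (begin
      ⊤ · ē          ≤⟨ ∧-greatest ≤-refl (≤-respʳ-≈ (sym (·-identityʳ ⊤)) (⊤-maximum _)) ⟩
      ⊤ · ē ∧ ⊤ · e  ≈⟨ ·-distribˡ-∧ ⊤ ē e ⟨
      ⊤ · (ē ∧ e)    ≈⟨ ·-cong refl (trans (∧-comm ē e) e∧ē≈⊥) ⟩
      ⊤ · ⊥          ≈⟨ ·-zeroʳ ⊥-minimum ⊤ ⟩
      ⊥              ∎)

    identityII⇒e≈⊤ : IdentityII A → e ≈ ⊤
    identityII⇒e≈⊤ ·-distribʳ-∧ = ē·⊤≤⊥⇒e≈⊤ (begin
      ē · ⊤          ≤⟨ ∧-greatest ≤-refl (≤-respʳ-≈ (sym (·-identityˡ ⊤)) (⊤-maximum _)) ⟩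
      ē · ⊤ ∧ e · ⊤  ≈⟨ ·-distribʳ-∧ ē e ⊤ ⟨
      (ē ∧ e) · ⊤    ≈⟨ ·-cong (trans (∧-comm ē e) e∧ē≈⊥) refl ⟩
      ⊥ · ⊤          ≈⟨ ·-zeroˡ ⊥-minimum ⊤ ⟩
      ⊥              ∎)

    identityIII⇒e≈⊤ : IdentityIII A → e ≈ ⊤
    identityIII⇒e≈⊤ \\-antidistrib-∧ = ē·⊤≤⊥⇒e≈⊤ (≤\\⇒·≤ (begin
      ⊤                ≤⟨ ·≤⇒≤\\ (≤-reflexive (·-zeroˡ ⊥-minimum ⊤)) ⟩
      ⊥ \\ ⊥           ≈⟨ \\-cong e∧ē≈⊥ refl ⟨
      (e ∧ ē) \\ ⊥     ≈⟨ \\-antidistrib-∧ e ē ⊥ ⟩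
      e \\ ⊥ ∨ ē \\ ⊥  ≤⟨ ∨-least (≤-trans (≤-reflexive (\\-identityˡ e-identity ⊥)) (⊥-minimum _)) ≤-refl ⟩
      ē \\ ⊥           ∎))

    identityIV⇒e≈⊤ : IdentityIV A → e ≈ ⊤
    identityIV⇒e≈⊤ //-antidistrib-∧ = ⊤·ē≤⊥⇒e≈⊤ (≤//⇒·≤ (begin
      ⊤                ≤⟨ ·≤⇒≤// (≤-reflexive (·-zeroʳ ⊥-minimum ⊤)) ⟩
      ⊥ // ⊥           ≈⟨ //-cong refl e∧ē≈⊥ ⟨
      ⊥ // (e ∧ ē)     ≈⟨ //-antidistrib-∧ ⊥ e ē ⟩
      ⊥ // e ∨ ⊥ // ē  ≤⟨ ∨-least (≤-trans (≤-reflexive (//-identityʳ e-identity ⊥)) (⊥-minimum _)) ≤-refl ⟩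
      ⊥ // ē           ∎))

    module _ (e≈⊤ : e ≈ ⊤) where

      e-maximum : Maximum _≤_ e
      e-maximum x = ≤-respʳ-≈ (sym e≈⊤) (⊤-maximum x)

      x≤x·x : ∀ x → x ≤ x · x
      x≤x·x x = from-complement (complement x)
        where
        from-complement : Σ Carrier (λ x̄ → x ∧ x̄ ≈ ⊥ × x ∨ x̄ ≈ ⊤) → x ≤ x · x
        from-complement (x̄ , x∧x̄≈⊥ , x∨x̄≈⊤) = begin
          x              ≈⟨ ·-identityʳ x ⟨
          x · e          ≈⟨ ·-cong refl (trans e≈⊤ (sym x∨x̄≈⊤)) ⟩
          x · (x ∨ x̄)    ≈⟨ ·-distribˡ-∨ x x x̄ ⟩
          x · x ∨ x · x̄  ≤⟨ ∨-least ≤-refl x·x̄≤x·x ⟩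
          x · x          ∎
          where
          x·x̄≤x·x : x · x̄ ≤ x · x
          x·x̄≤x·x = begin
            x · x̄  ≤⟨ x·y≤x∧y e-identity e-maximum x x̄ ⟩
            x ∧ x̄  ≈⟨ x∧x̄≈⊥ ⟩
            ⊥      ≤⟨ ⊥-minimum _ ⟩
            x · x  ∎

      ·≈∧ : ∀ x y → x · y ≈ x ∧ y
      ·≈∧ x y = antisym (x·y≤x∧y e-identity e-maximum x y) (begin
        x ∧ y              ≤⟨ x≤x·x (x ∧ y) ⟩
        (x ∧ y) · (x ∧ y)  ≤⟨ ·-monoˡ-≤ (x∧y≤x x y) ⟩
        x · (x ∧ y)        ≤⟨ ·-monoʳ-≤ (x∧y≤y x y) ⟩
        x · y              ∎)

      ∧-distribˡ-∨ : _DistributesOverˡ_ _≈_ _∧_ _∨_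
      ∧-distribˡ-∨ x y z = begin-equality
        x ∧ (y ∨ z)          ≈⟨ ·≈∧ x (y ∨ z) ⟨
        x · (y ∨ z)          ≈⟨ ·-distribˡ-∨ x y z ⟩
        x · y ∨ x · z        ≈⟨ ∨-cong (·≈∧ x y) (·≈∧ x z) ⟩
        x ∧ y ∨ x ∧ z        ∎

      e≈⊤⇒isBooleanResiduatedBinar : IsBooleanResiduatedBinar A
      e≈⊤⇒isBooleanResiduatedBinar =
        ·≈∧ , ∧-distribˡ-∨⇒isDistributiveLattice lattice ∧-distribˡ-∨ , complemented

corollary4p3 : ∀ {c ℓ : Level} (A : ResiduatedBinar c ℓ) →
    Unital A → Complemented A →
    (IdentityI A ⊎ IdentityII A ⊎ IdentityIII A ⊎ IdentityIV A) →
    IsBooleanResiduatedBinar A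
corollary4p3 A unital complemented identity =
  e≈⊤⇒isBooleanResiduatedBinar (e≈⊤ identity)
  where
  open ResiduatedBinar A using (_≈_)
  open UnitalComplemented A unital complemented
  e≈⊤ : IdentityI A ⊎ IdentityII A ⊎ IdentityIII A ⊎ IdentityIV A → e ≈ ⊤
  e≈⊤ (inj₁ I)                = identityI⇒e≈⊤ I
  e≈⊤ (inj₂ (inj₁ II))        = identityII⇒e≈⊤ II
  e≈⊤ (inj₂ (inj₂ (inj₁ III))) = identityIII⇒e≈⊤ III
  e≈⊤ (inj₂ (inj₂ (inj₂ IV)))  = identityIV⇒e≈⊤ IV
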